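{- For every conditional relation $R$, $f_R(R)\subseteq f_C(u(R))$.
   Context: Composition of $f\colon A\to B$, $g\colon B\to C$ is written $f;g$. Fix a category $\mathbf C$ with distinguished object $0$ and a representative class $\kappa$ of commuting squares: for every commuting square $\alpha_1;\delta_1=\alpha_2;\delta_2$ there are $(\alpha_1,\alpha_2,\beta_1,\beta_2)\in\kappa$ (a commuting square) and $\gamma$ with $\delta_1=\beta_1;\gamma$, $\delta_2=\beta_2;\gamma$; $\kappa(\alpha_1,\alpha_2)$ is the set of $(\beta_1,\beta_2)$ with $(\alpha_1,\alpha_2,\beta_1,\beta_2)\in\kappa$. Conditions over $A$ are defined inductively as $(A,\mathcal Q,S)$, $\mathcal Q\in\{\forall,\exists\}$, $S$ a finite set of pairs $(h,\mathcal A')$ with $h\colon A\to A'$, $\mathcal A'$ a condition over $A'$. For $a\colon A\to B$: $a\models(A,\forall,S)$ iff for all $(h,\mathcal A')\in S$ and all $g$ with $a=h;g$, $g\models\mathcal A'$; $a\models(A,\exists,S)$ iff some $(h,\mathcal A')\in S$ and $g$ satisfy $a=h;g$, $g\models\mathcal A'$. $\mathcal A\models\mathcal B$: every arrow satisfying $\mathcal A$ satisfies $\mathcal B$. Boolean connectives have the standard semantics. Shift along $c\colon A\to B$: $(A,\mathcal Q,S)_{\downarrow c}=(B,\mathcal Q,\{(\beta,\mathcal A'_{\downarrow\alpha})\mid(h,\mathcal A')\in S,(\alpha,\beta)\in\kappa(h,c)\})$; it satisfies $c;d\models\mathcal A\iff d\models\mathcal A_{\downarrow c}$. A conditional reactive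 system is a set $\mathcal S$ of rules $(\ell,r,\mathcal R)$, $\ell,r\colon0\to I$, $\mathcal R$ a condition over $I$. Context step $a\xrightarrow[C]{f,\ \mathcal A}a'$ ($a\colon0\to J$, $f\colon J\to K$, $a'\colon0\to K$, $\mathcal A$ over $K$): there are a rule $(\ell,r,\mathcal R)\in\mathcal S$ and $c\colon I\to K$ with $a;f=\ell;c$, $a'=r;c$, $\mathcal A\models\mathcal R_{\downarrow c}$. Representative step $a\xrightarrow[R]{f,\ \mathcal A}a'$: a context step with additionally $(f,c)\in\kappa(a,\ell)$ and $\mathcal A=\mathcal R_{\downarrow c}$. A conditional relation is a set of triples $(a,b,\mathcal C)$, $a,b\colon0\to J$, $\mathcal C$ a condition over $J$. $\mathcal D\models\bigvee_{i\in I}\mathcal E_i$ (possibly infinite $I$): every arrow satisfying $\mathcal D$ satisfies some $\mathcal E_i$. $u(R)=\{(a;d,\ b;d,\ \mathcal C_{\downarrow d})\mid(a,b,\mathcal C)\in R,\ a,b\colon0\to J,\ d\colon J\to K\}$. $f_C(R)$ is the set of triples $(a,b,\mathcal C)$ such that for each context step $a\xrightarrow[C]{f,\ \mathcal A}a'$ there are an index set $I$, context steps $b\xrightarrow[C]{f,\ \mathcal B_i}b'_i$ and conditions $\mathcal C'_i$ with $(a',b'_i,\mathcal C'_i)\in R$ and $\mathcal A\land\mathcal C_{\downarrow f}\models\bigvee_{i\in I}(\mathcal C'_i\land\mathcal B_i)$, and symmetrically each context step of $b$ is answered by context steps of $a$. $f_R(R)$ is defined identically except that only representative steps $a\xrightarrow[R]{f,\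 \mathcal A}a'$ (resp. representative steps of $b$) must be answered (still by context steps). -}

module Defs where

open import Data.Empty using (⊥)
open import Data.Unit using (⊤)
open import Data.Product using (Σ; Σ-syntax; _×_; _,_)
open import Data.Sum using (_⊎_)
open import Data.List using (List; []; _∷_)
open import Data.List.Membership.Propositional using (_∈_)
open import Relation.Binary.PropositionalEquality using (_≡_)

-- A category (hom-sets with propositional equality of arrows), composition
-- written in diagrammatic order f ⨾ g (the paper's f;g), with a
-- distinguished object 𝟘 and a representative class κ of commuting squares.
-- κ α₁ α₂ is the (finite, as needed for the shift of a condition to be a
-- condition with finitely many branches) list of pairs (β₁ , β₂).
record Setting : Set₁ where
  infixl 5 _⨾_
  field
    Obj   : Set
    Hom   : Obj → Obj → Set
    _⨾_   : ∀ {A B C} → Hom A B → Hom B C → Hom A C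
    id    : ∀ {A} → Hom A A
    idˡ   : ∀ {A B} (f : Hom A B) → id ⨾ f ≡ f
    idʳ   : ∀ {A B} (f : Hom A B) → f ⨾ id ≡ f
    assoc : ∀ {A B C D} (f : Hom A B) (g : Hom B C) (h : Hom C D) →
            (f ⨾ g) ⨾ h ≡ f ⨾ (g ⨾ h)
    𝟘     : Obj
    κ     : ∀ {A B₁ B₂} → Hom A B₁ → Hom A B₂ →
            List (Σ[ D ∈ Obj ] (Hom B₁ D × Hom B₂ D))
    κ-comm : ∀ {A B₁ B₂ D} {α₁ : Hom A B₁} {α₂ : Hom A B₂}
               {β₁ : Hom B₁ D} {β₂ : Hom B₂ D} →
             (D , β₁ , β₂) ∈ κ α₁ α₂ → α₁ ⨾ β₁ ≡ α₂ ⨾ β₂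
    κ-rep : ∀ {A B₁ B₂ E} (α₁ : Hom A B₁) (α₂ : Hom A B₂)
              (δ₁ : Hom B₁ E) (δ₂ : Hom B₂ E) → α₁ ⨾ δ₁ ≡ α₂ ⨾ δ₂ →
            Σ[ D ∈ Obj ] Σ[ β₁ ∈ Hom B₁ D ] Σ[ β₂ ∈ Hom B₂ D ]
              ((D , β₁ , β₂) ∈ κ α₁ α₂ ×
               Σ[ γ ∈ Hom D E ] (δ₁ ≡ β₁ ⨾ γ × δ₂ ≡ β₂ ⨾ γ))

data Quant : Set where
  ∀q ∃q : Quant

module Theory (𝐒 : Setting) where
  open Setting 𝐒

  -- Conditions (A , Q , S): S is a finite set of pairs (h , A'),
  -- represented as a list of branches.
  data Cond (A : Obj) : Set
  data Branches (A : Obj) : Set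

  data Cond A where
    cond : Quant → Branches A → Cond A

  data Branches A where
    []  : Branches A
    br  : ∀ {A'} → Hom A A' → Cond A' → Branches A → Branches A

  Sat    : ∀ {A B} → Cond A → Hom A B → Set
  SatAll : ∀ {A B} → Branches A → Hom A B → Set
  SatAny : ∀ {A B} → Branches A → Hom A B → Set

  Sat (cond ∀q bs) a = SatAll bs a
  Sat (cond ∃q bs) a = SatAny bs a

  SatAll []            a = ⊤
  SatAll (br {A'} h 𝒜 bs) a =
    (∀ (g : Hom A' _) → a ≡ h ⨾ g → Sat 𝒜 g) × SatAll bs a

  SatAny []            a = ⊥
  SatAny (br {A'} h 𝒜 bs) a =
    (Σ[ g ∈ Hom A' _ ] (a ≡ h ⨾ g × Sat 𝒜 g)) ⊎ SatAny bs a

  _⊨_ : ∀ {A} → Cond A → Cond A → Set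
  _⊨_ {A} 𝒜 ℬ = ∀ {B} (a : Hom A B) → Sat 𝒜 a → Sat ℬ a

  shift   : ∀ {A B} → Cond A → Hom A B → Cond B
  shiftBr : ∀ {A B} → Branches A → Hom A B → Branches B
  shiftSq : ∀ {A' B} → Cond A' → List (Σ[ D ∈ Obj ] (Hom A' D × Hom B D)) →
            Branches B → Branches B

  shift (cond q bs) c = cond q (shiftBr bs c)

  shiftBr []            c = []
  shiftBr (br h 𝒜 bs)   c = shiftSq 𝒜 (κ h c) (shiftBr bs c)

  shiftSq 𝒜 []                    acc = acc
  shiftSq 𝒜 ((D , α , β) ∷ sqs) acc = br β (shift 𝒜 α) (shiftSq 𝒜 sqs acc)

  Rule : Set
  Rule = Σ[ I ∈ Obj ] (Hom 𝟘 I × Hom 𝟘 I × Cond I)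

  Triple : Set
  Triple = Σ[ J ∈ Obj ] (Hom 𝟘 J × Hom 𝟘 J × Cond J)

  CRel : Set₁
  CRel = Triple → Set

  data u (R : CRel) : Triple → Set where
    mk-u : ∀ {J K} (a b : Hom 𝟘 J) (𝒞 : Cond J) (d : Hom J K) →
           R (J , a , b , 𝒞) → u R (K , a ⨾ d , b ⨾ d , shift 𝒞 d)

  _⊆_ : (Triple → Set₁) → (Triple → Set₁) → Set₁
  P ⊆ Q = ∀ t → P t → Q t

  module Reactive (𝒮 : Rule → Set) where

    CStep : ∀ {J K} → Hom 𝟘 J → Hom J K → Cond K → Hom 𝟘 K → Set
    CStep {J} {K} a f 𝒜 a' =
      Σ[ I ∈ Obj ] Σ[ ℓ ∈ Hom 𝟘 I ] Σ[ r ∈ Hom 𝟘 I ] Σ[ ℛ ∈ Cond I ]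
      Σ[ c ∈ Hom I K ]
        (𝒮 (I , ℓ , r , ℛ) × a ⨾ f ≡ ℓ ⨾ c × a' ≡ r ⨾ c × 𝒜 ⊨ shift ℛ c)

    RStep : ∀ {J K} → Hom 𝟘 J → Hom J K → Cond K → Hom 𝟘 K → Set
    RStep {J} {K} a f 𝒜 a' =
      Σ[ I ∈ Obj ] Σ[ ℓ ∈ Hom 𝟘 I ] Σ[ r ∈ Hom 𝟘 I ] Σ[ ℛ ∈ Cond I ]
      Σ[ c ∈ Hom I K ]
        (𝒮 (I , ℓ , r , ℛ) × a ⨾ f ≡ ℓ ⨾ c × a' ≡ r ⨾ c × 𝒜 ⊨ shift ℛ c ×
         (K , f , c) ∈ κ a ℓ × 𝒜 ≡ shift ℛ c)

    -- "a step of x with label (f , 𝒜) to x' is answered by context steps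
    --  of y, relating (x' , y'ᵢ) in R (in the given orientation)"
    -- 𝒜 ∧ 𝒞↓f ⊨ ⋁ᵢ (𝒞'ᵢ ∧ ℬᵢ), with ∧ , ⋁ taken semantically.
    AnswerL : CRel → ∀ {J K} → Hom 𝟘 J → Cond J → Hom J K → Cond K →
              Hom 𝟘 K → Set₁
    AnswerL R {J} {K} b 𝒞 f 𝒜 a' =
      Σ[ Ix ∈ Set ] Σ[ b' ∈ (Ix → Hom 𝟘 K) ] Σ[ ℬ ∈ (Ix → Cond K) ]
      Σ[ 𝒞' ∈ (Ix → Cond K) ]
        ((∀ i → CStep b f (ℬ i) (b' i)) ×
         (∀ i → R (K , a' , b' i , 𝒞' i)) ×
         (∀ {L} (x : Hom K L) → Sat 𝒜 x → Sat (shift 𝒞 f) x →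
            Σ[ i ∈ Ix ] (Sat (𝒞' i) x × Sat (ℬ i) x)))

    AnswerR : CRel → ∀ {J K} → Hom 𝟘 J → Cond J → Hom J K → Cond K →
              Hom 𝟘 K → Set₁
    AnswerR R {J} {K} a 𝒞 f ℬ b' =
      Σ[ Ix ∈ Set ] Σ[ a' ∈ (Ix → Hom 𝟘 K) ] Σ[ 𝒜 ∈ (Ix → Cond K) ]
      Σ[ 𝒞' ∈ (Ix → Cond K) ]
        ((∀ i → CStep a f (𝒜 i) (a' i)) ×
         (∀ i → R (K , a' i , b' , 𝒞' i)) ×
         (∀ {L} (x : Hom K L) → Sat ℬ x → Sat (shift 𝒞 f) x →
            Σ[ i ∈ Ix ] (Sat (𝒞' i) x × Sat (𝒜 i) x)))

    fC : CRel → Triple → Set₁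
    fC R (J , a , b , 𝒞) =
      (∀ {K} (f : Hom J K) (𝒜 : Cond K) (a' : Hom 𝟘 K) →
         CStep a f 𝒜 a' → AnswerL R b 𝒞 f 𝒜 a') ×
      (∀ {K} (f : Hom J K) (ℬ : Cond K) (b' : Hom 𝟘 K) →
         CStep b f ℬ b' → AnswerR R a 𝒞 f ℬ b')

    fR : CRel → Triple → Set₁
    fR R (J , a , b , 𝒞) =
      (∀ {K} (f : Hom J K) (𝒜 : Cond K) (a' : Hom 𝟘 K) →
         RStep a f 𝒜 a' → AnswerL R b 𝒞 f 𝒜 a') ×
      (∀ {K} (f : Hom J K) (ℬ : Cond K) (b' : Hom 𝟘 K) →
         RStep b f ℬ b' → AnswerR R a 𝒞 f ℬ b')

module Submission where

-- The shift 𝒜↓c is characterised semantically: d ⊨ 𝒜↓c iff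
--    c;d ⊨ 𝒜 (shift-intro / shift-elim).  This is proved by induction on
--    conditions, using that κ is a representative class of squares.  As
--    consequences, shifting is monotone for ⊨ and shifting along c;γ is
--    shifting along c and then along γ.
--  * Steps.  Every context step factors through a representative step:
--    a --[f,𝒜]-->_C a' yields a representative step a --[f₀,ℛ↓c₀]-->_R a₀
--    and γ with f = f₀;γ, a' = a₀;γ and 𝒜 ⊨ (ℛ↓c₀)↓γ.  Conversely a
--    context step can be extended by any γ.
--  * Answers.  An answer to a step labelled (f₀ , 𝒜₀) by R extends, along
--    γ, to an answer to any step labelled (f₀;γ , 𝒜) with 𝒜 ⊨ 𝒜₀↓γ, by
--    u(R).  Composing the factorisation with this extension answers every
--    context step, on each side of the relation.

open import Defs
open import Data.Unit using (tt)
open import Data.Product using (Σ-syntax; _×_; _,_)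
open import Data.Sum using (_⊎_; inj₁; inj₂)
open import Data.List using (List; []; _∷_)
open import Data.List.Relation.Unary.All using (All; []; _∷_; tabulate; lookup)
open import Data.List.Relation.Unary.Any using (Any; here; there)
open import Data.List.Membership.Propositional using (_∈_; find; lose)
open import Relation.Binary.PropositionalEquality
  using (_≡_; refl; sym; trans; cong; subst; module ≡-Reasoning)

module ShiftSemantics (𝐒 : Setting) where
  open Setting 𝐒
  open Theory 𝐒

  Square : Obj → Obj → Set
  Square A' B = Σ[ D ∈ Obj ] (Hom A' D × Hom B D)

  Squares : Obj → Obj → Set
  Squares A' B = List (Square A' B)

  Passes : ∀ {A' B C} → Cond A' → Hom B C → Square A' B → Set
  Passes 𝒜 d (D , α , β) = ∀ g → d ≡ β ⨾ g → Sat (shift 𝒜 α) g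

  Meets : ∀ {A' B C} → Cond A' → Hom B C → Square A' B → Set
  Meets {C = C} 𝒜 d (D , α , β) = Σ[ g ∈ Hom D C ] (d ≡ β ⨾ g × Sat (shift 𝒜 α) g)

  shiftSq-all⁻ : ∀ {A' B C} (𝒜 : Cond A') (sqs : Squares A' B) (acc : Branches B)
                 (d : Hom B C) → SatAll (shiftSq 𝒜 sqs acc) d →
                 All (Passes 𝒜 d) sqs × SatAll acc d
  shiftSq-all⁻ 𝒜 [] acc d s = [] , s
  shiftSq-all⁻ 𝒜 (_ ∷ sqs) acc d (p , s) =
    let ps , t = shiftSq-all⁻ 𝒜 sqs acc d s in p ∷ ps , t

  shiftSq-all⁺ : ∀ {A' B C} (𝒜 : Cond A') (sqs : Squares A' B) (acc : Branches B)
                 (d : Hom B C) → All (Passes 𝒜 d) sqs → SatAll acc d →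
                 SatAll (shiftSq 𝒜 sqs acc) d
  shiftSq-all⁺ 𝒜 [] acc d [] s = s
  shiftSq-all⁺ 𝒜 (_ ∷ sqs) acc d (p ∷ ps) s = p , shiftSq-all⁺ 𝒜 sqs acc d ps s

  shiftSq-any⁻ : ∀ {A' B C} (𝒜 : Cond A') (sqs : Squares A' B) (acc : Branches B)
                 (d : Hom B C) → SatAny (shiftSq 𝒜 sqs acc) d →
                 Any (Meets 𝒜 d) sqs ⊎ SatAny acc d
  shiftSq-any⁻ 𝒜 [] acc d s = inj₂ s
  shiftSq-any⁻ 𝒜 (_ ∷ sqs) acc d (inj₁ m) = inj₁ (here m)
  shiftSq-any⁻ 𝒜 (_ ∷ sqs) acc d (inj₂ s) with shiftSq-any⁻ 𝒜 sqs acc d s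
  ... | inj₁ ms = inj₁ (there ms)
  ... | inj₂ t  = inj₂ t

  shiftSq-any⁺ : ∀ {A' B C} (𝒜 : Cond A') (sqs : Squares A' B) (acc : Branches B)
                 (d : Hom B C) → Any (Meets 𝒜 d) sqs ⊎ SatAny acc d →
                 SatAny (shiftSq 𝒜 sqs acc) d
  shiftSq-any⁺ 𝒜 [] acc d (inj₂ s) = s
  shiftSq-any⁺ 𝒜 (_ ∷ sqs) acc d (inj₁ (here m)) = inj₁ m
  shiftSq-any⁺ 𝒜 (_ ∷ sqs) acc d (inj₁ (there ms)) =
    inj₂ (shiftSq-any⁺ 𝒜 sqs acc d (inj₁ ms))
  shiftSq-any⁺ 𝒜 (_ ∷ sqs) acc d (inj₂ s) = inj₂ (shiftSq-any⁺ 𝒜 sqs acc d (inj₂ s))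

  through-square : ∀ {A A' B C D} {h : Hom A A'} {c : Hom A B} {α : Hom A' D}
                   {β : Hom B D} {d : Hom B C} (g : Hom D C) →
                   (D , α , β) ∈ κ h c → d ≡ β ⨾ g → c ⨾ d ≡ h ⨾ (α ⨾ g)
  through-square {h = h} {c} {α} {β} {d} g sq d≡βg = begin
    c ⨾ d          ≡⟨ cong (c ⨾_) d≡βg ⟩
    c ⨾ (β ⨾ g)    ≡⟨ sym (assoc c β g) ⟩
    (c ⨾ β) ⨾ g    ≡⟨ cong (_⨾ g) (sym (κ-comm sq)) ⟩
    (h ⨾ α) ⨾ g    ≡⟨ assoc h α g ⟩
    h ⨾ (α ⨾ g)    ∎
    where open ≡-Reasoning

  shift-intro    : ∀ {A B C} (𝒜 : Cond A) (c : Hom A B) (d : Hom B C) →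
                   Sat 𝒜 (c ⨾ d) → Sat (shift 𝒜 c) d
  shift-introAll : ∀ {A B C} (bs : Branches A) (c : Hom A B) (d : Hom B C) →
                   SatAll bs (c ⨾ d) → SatAll (shiftBr bs c) d
  shift-introAny : ∀ {A B C} (bs : Branches A) (c : Hom A B) (d : Hom B C) →
                   SatAny bs (c ⨾ d) → SatAny (shiftBr bs c) d

  shift-intro (cond ∀q bs) = shift-introAll bs
  shift-intro (cond ∃q bs) = shift-introAny bs

  shift-introAll [] c d _ = tt
  shift-introAll (br h 𝒜 bs) c d (allᵍ , rest) =
    shiftSq-all⁺ 𝒜 (κ h c) (shiftBr bs c) d
      (tabulate λ { {D , α , β} sq g d≡βg →
        shift-intro 𝒜 α g (allᵍ (α ⨾ g) (through-square g sq d≡βg)) })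
      (shift-introAll bs c d rest)

  shift-introAny [] c d ()
  shift-introAny (br h 𝒜 bs) c d (inj₁ (g , cd≡hg , sat))
    with κ-rep h c g d (sym cd≡hg)
  ... | D , α , β , sq , γ , g≡αγ , d≡βγ =
    shiftSq-any⁺ 𝒜 (κ h c) (shiftBr bs c) d
      (inj₁ (lose sq (γ , d≡βγ , shift-intro 𝒜 α γ (subst (Sat 𝒜) g≡αγ sat))))
  shift-introAny (br h 𝒜 bs) c d (inj₂ rest) =
    shiftSq-any⁺ 𝒜 (κ h c) (shiftBr bs c) d (inj₂ (shift-introAny bs c d rest))

  shift-elim    : ∀ {A B C} (𝒜 : Cond A) (c : Hom A B) (d : Hom B C) →
                  Sat (shift 𝒜 c) d → Sat 𝒜 (c ⨾ d)
  shift-elimAll : ∀ {A B C} (bs : Branches A) (c : Hom A B) (d : Hom B C) →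
                  SatAll (shiftBr bs c) d → SatAll bs (c ⨾ d)
  shift-elimAny : ∀ {A B C} (bs : Branches A) (c : Hom A B) (d : Hom B C) →
                  SatAny (shiftBr bs c) d → SatAny bs (c ⨾ d)

  shift-elim (cond ∀q bs) = shift-elimAll bs
  shift-elim (cond ∃q bs) = shift-elimAny bs

  shift-elimAll [] c d _ = tt
  shift-elimAll (br h 𝒜 bs) c d s with shiftSq-all⁻ 𝒜 (κ h c) (shiftBr bs c) d s
  ... | passes , rest = branch , shift-elimAll bs c d rest
    where
    -- a factorisation c;d = h;g factors through a representative square
    branch : ∀ g → c ⨾ d ≡ h ⨾ g → Sat 𝒜 g
    branch g cd≡hg with κ-rep h c g d (sym cd≡hg)
    ... | D , α , β , sq , γ , g≡αγ , d≡βγ =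
      subst (Sat 𝒜) (sym g≡αγ) (shift-elim 𝒜 α γ (lookup passes sq γ d≡βγ))

  shift-elimAny [] c d ()
  shift-elimAny (br h 𝒜 bs) c d s with shiftSq-any⁻ 𝒜 (κ h c) (shiftBr bs c) d s
  ... | inj₂ rest = inj₂ (shift-elimAny bs c d rest)
  ... | inj₁ meets with find meets
  ...   | (D , α , β) , sq , g , d≡βg , sat =
    inj₁ (α ⨾ g , through-square g sq d≡βg , shift-elim 𝒜 α g sat)

  shift-mono : ∀ {A B} (𝒜 ℬ : Cond A) → 𝒜 ⊨ ℬ → (γ : Hom A B) → shift 𝒜 γ ⊨ shift ℬ γ
  shift-mono 𝒜 ℬ 𝒜⊨ℬ γ x sat =
    shift-intro ℬ γ x (𝒜⊨ℬ (γ ⨾ x) (shift-elim 𝒜 γ x sat))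

  shift-⨾⁻ : ∀ {A B C} (𝒜 : Cond A) (c : Hom A B) (γ : Hom B C) →
             shift 𝒜 (c ⨾ γ) ⊨ shift (shift 𝒜 c) γ
  shift-⨾⁻ 𝒜 c γ x sat =
    shift-intro (shift 𝒜 c) γ x
      (shift-intro 𝒜 c (γ ⨾ x) (subst (Sat 𝒜) (assoc c γ x) (shift-elim 𝒜 (c ⨾ γ) x sat)))

  shift-⨾⁺ : ∀ {A B C} (𝒜 : Cond A) (c : Hom A B) (γ : Hom B C) →
             shift (shift 𝒜 c) γ ⊨ shift 𝒜 (c ⨾ γ)
  shift-⨾⁺ 𝒜 c γ x sat =
    shift-intro 𝒜 (c ⨾ γ) x
      (subst (Sat 𝒜) (sym (assoc c γ x))
        (shift-elim 𝒜 c (γ ⨾ x) (shift-elim (shift 𝒜 c) γ x sat)))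

module Simulation (𝐒 : Setting) (𝒮 : Theory.Rule 𝐒 → Set) (R : Theory.CRel 𝐒) where
  open Setting 𝐒
  open Theory 𝐒
  open Reactive 𝒮
  open ShiftSemantics 𝐒
  open ≡-Reasoning

  extend-step : ∀ {J K K'} {y : Hom 𝟘 J} {f : Hom J K} {ℬ : Cond K} {y' : Hom 𝟘 K} →
                CStep y f ℬ y' → (γ : Hom K K') → CStep y (f ⨾ γ) (shift ℬ γ) (y' ⨾ γ)
  extend-step {y = y} {f} {ℬ} {y'} (I , ℓ , r , ℛ , c , rule , yf≡ℓc , y'≡rc , ℬ⊨ℛc) γ =
    I , ℓ , r , ℛ , c ⨾ γ , rule , source , target ,
    λ x sat → shift-⨾⁺ ℛ c γ x (shift-mono ℬ (shift ℛ c) ℬ⊨ℛc γ x sat)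
    where
    source : y ⨾ (f ⨾ γ) ≡ ℓ ⨾ (c ⨾ γ)
    source = begin
      y ⨾ (f ⨾ γ)   ≡⟨ sym (assoc y f γ) ⟩
      (y ⨾ f) ⨾ γ   ≡⟨ cong (_⨾ γ) yf≡ℓc ⟩
      (ℓ ⨾ c) ⨾ γ   ≡⟨ assoc ℓ c γ ⟩
      ℓ ⨾ (c ⨾ γ)   ∎
    target : y' ⨾ γ ≡ r ⨾ (c ⨾ γ)
    target = trans (cong (_⨾ γ) y'≡rc) (assoc r c γ)

  record Factorisation {J K} (x : Hom 𝟘 J) (f : Hom J K) (𝒜 : Cond K) (x' : Hom 𝟘 K) : Set where
    constructor factorisation
    field
      K₀       : Obj
      f₀       : Hom J K₀
      γ        : Hom K₀ K
      𝒜₀       : Cond K₀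
      x₀       : Hom 𝟘 K₀
      rep-step : RStep x f₀ 𝒜₀ x₀
      f≡f₀γ    : f ≡ f₀ ⨾ γ
      x'≡x₀γ   : x' ≡ x₀ ⨾ γ
      𝒜⊨𝒜₀γ    : 𝒜 ⊨ shift 𝒜₀ γ

  -- Every context step factors through a representative one: the square
  -- x;f = ℓ;c factors through a representative square x;f₀ = ℓ;c₀ in κ.
  factor : ∀ {J K} {x : Hom 𝟘 J} {f : Hom J K} {𝒜 : Cond K} {x' : Hom 𝟘 K} →
           CStep x f 𝒜 x' → Factorisation x f 𝒜 x'
  factor {x = x} {f} {𝒜} {x'} (I , ℓ , r , ℛ , c , rule , xf≡ℓc , x'≡rc , 𝒜⊨ℛc)
    with κ-rep x ℓ f c xf≡ℓc
  ... | K₀ , f₀ , c₀ , sq , γ , f≡f₀γ , c≡c₀γ =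
    factorisation K₀ f₀ γ (shift ℛ c₀) (r ⨾ c₀)
      (I , ℓ , r , ℛ , c₀ , rule , κ-comm sq , refl , (λ _ sat → sat) , sq , refl)
      f≡f₀γ target
      (λ y sat → shift-⨾⁻ ℛ c₀ γ y (subst (λ c → Sat (shift ℛ c) y) c≡c₀γ (𝒜⊨ℛc y sat)))
    where
    target : x' ≡ (r ⨾ c₀) ⨾ γ
    target = begin
      x'             ≡⟨ x'≡rc ⟩
      r ⨾ c          ≡⟨ cong (r ⨾_) c≡c₀γ ⟩
      r ⨾ (c₀ ⨾ γ)   ≡⟨ sym (assoc r c₀ γ) ⟩
      (r ⨾ c₀) ⨾ γ   ∎

  -- y answers a step of its partner labelled (f , 𝒜) by context steps whose
  -- results y'ᵢ, with conditions 𝒞'ᵢ, satisfy P; both AnswerL and AnswerR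
  -- are instances of this.
  Answer : ∀ {J K} → (Hom 𝟘 K → Cond K → Set) → Hom 𝟘 J → Cond J → Hom J K → Cond K → Set₁
  Answer {J} {K} P y 𝒞 f 𝒜 =
    Σ[ Ix ∈ Set ] Σ[ y' ∈ (Ix → Hom 𝟘 K) ] Σ[ ℬ ∈ (Ix → Cond K) ]
    Σ[ 𝒞' ∈ (Ix → Cond K) ]
      ((∀ i → CStep y f (ℬ i) (y' i)) ×
       (∀ i → P (y' i) (𝒞' i)) ×
       (∀ {L} (x : Hom K L) → Sat 𝒜 x → Sat (shift 𝒞 f) x →
          Σ[ i ∈ Ix ] (Sat (𝒞' i) x × Sat (ℬ i) x)))

  extend-answer : ∀ {J K₀ K} {P : Hom 𝟘 K₀ → Cond K₀ → Set} {P' : Hom 𝟘 K → Cond K → Set}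
                  {y : Hom 𝟘 J} {𝒞 : Cond J} {f₀ : Hom J K₀} {𝒜₀ : Cond K₀} {𝒜 : Cond K}
                  (γ : Hom K₀ K) →
                  (∀ y' 𝒞' → P y' 𝒞' → P' (y' ⨾ γ) (shift 𝒞' γ)) →
                  𝒜 ⊨ shift 𝒜₀ γ →
                  Answer P y 𝒞 f₀ 𝒜₀ → Answer P' y 𝒞 (f₀ ⨾ γ) 𝒜
  extend-answer {K = K} {𝒞 = 𝒞} {f₀} {𝒜₀} {𝒜} γ lift 𝒜⊨𝒜₀γ
                (Ix , y' , ℬ , 𝒞' , steps , related , covers) =
    Ix , (λ i → y' i ⨾ γ) , (λ i → shift (ℬ i) γ) , (λ i → shift (𝒞' i) γ) ,
    (λ i → extend-step {ℬ = ℬ i} (steps i) γ) , (λ i → lift (y' i) (𝒞' i) (related i)) ,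
    covers'
    where
    covers' : ∀ {L} (x : Hom K L) → Sat 𝒜 x → Sat (shift 𝒞 (f₀ ⨾ γ)) x →
              Σ[ i ∈ Ix ] (Sat (shift (𝒞' i) γ) x × Sat (shift (ℬ i) γ) x)
    covers' x sat𝒜 sat𝒞 with covers (γ ⨾ x)
      (shift-elim 𝒜₀ γ x (𝒜⊨𝒜₀γ x sat𝒜))
      (shift-elim (shift 𝒞 f₀) γ x (shift-⨾⁻ 𝒞 f₀ γ x sat𝒞))
    ... | i , sat𝒞' , satℬ = i , shift-intro (𝒞' i) γ x sat𝒞' , shift-intro (ℬ i) γ x satℬ

  -- Which component of a triple is the partner making the step.
  data Side : Set where
    forward backward : Side

  pairing : Side → ∀ {K} → Hom 𝟘 K → Hom 𝟘 K → Cond K → Triple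
  pairing forward  {K} x y 𝒞 = K , x , y , 𝒞
  pairing backward {K} x y 𝒞 = K , y , x , 𝒞

  u-extend : ∀ (s : Side) {K K'} (x y : Hom 𝟘 K) (𝒞 : Cond K) (d : Hom K K') →
             R (pairing s x y 𝒞) → u R (pairing s (x ⨾ d) (y ⨾ d) (shift 𝒞 d))
  u-extend forward  x y 𝒞 d = mk-u x y 𝒞 d
  u-extend backward x y 𝒞 d = mk-u y x 𝒞 d

  simulation : ∀ (s : Side) {J} {x y : Hom 𝟘 J} {𝒞 : Cond J} →
    (∀ {K} (f : Hom J K) (𝒜 : Cond K) (x' : Hom 𝟘 K) → RStep x f 𝒜 x' →
       Answer (λ y' 𝒞' → R (pairing s x' y' 𝒞')) y 𝒞 f 𝒜) →
    (∀ {K} (f : Hom J K) (𝒜 : Cond K) (x' : Hom 𝟘 K) → CStep x f 𝒜 x' →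
       Answer (λ y' 𝒞' → u R (pairing s x' y' 𝒞')) y 𝒞 f 𝒜)
  simulation s {y = y} {𝒞} answer f 𝒜 x' step with factor {𝒜 = 𝒜} step
  ... | factorisation _ f₀ γ 𝒜₀ x₀ rep-step refl refl 𝒜⊨𝒜₀γ =
    extend-answer {P = λ y' 𝒞' → R (pairing s x₀ y' 𝒞')}
      {P' = λ y' 𝒞' → u R (pairing s (x₀ ⨾ γ) y' 𝒞')} {y = y} {𝒞} {𝒜₀ = 𝒜₀} {𝒜} γ
      (λ y' 𝒞' → u-extend s x₀ y' 𝒞' γ) 𝒜⊨𝒜₀γ (answer f₀ 𝒜₀ x₀ rep-step)

lemma5p14 : (𝐒 : Setting) (𝒮 : Theory.Rule 𝐒 → Set) (R : Theory.CRel 𝐒) →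
    Theory._⊆_ 𝐒 (Theory.Reactive.fR 𝐒 𝒮 R) (Theory.Reactive.fC 𝐒 𝒮 (Theory.u 𝐒 R))
lemma5p14 𝐒 𝒮 R (J , a , b , 𝒞) (answers-of-a , answers-of-b) =
  simulation forward {x = a} {b} {𝒞} answers-of-a ,
  simulation backward {x = b} {a} {𝒞} answers-of-b
  where open Simulation 𝐒 𝒮 R
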